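{- If the hypergraph $F$ is not an orderly bipartite forest with singletons, then there is a constant $\gamma>1$ such that $\mathrm{ex}_e(F,n)\gg n^{\gamma}$; in particular $\mathrm{ex}_e(F,n)$ is not nearly linear.
   Context: A hypergraph $H=(E_i:i\in I)$ is a finite list of finite nonempty subsets of $\mathbb{N}$ (repetitions allowed); simple if edges are pairwise distinct; $v(H)=|\bigcup_iE_i|$, $e(H)=|I|$. $H$ contains $H'=(E'_i:i\in I')$ ($H\succ H'$) if there exist an increasing injection $\phi:\bigcup H'\to\bigcup H$ and an injection $f:I'\to I$ with $v\in E'_i\Rightarrow\phi(v)\in E_{f(i)}$. $\mathrm{ex}_e(F,n)=\max\{e(H): H\not\succ F,\ H\text{ simple},\ v(H)\le n\}$. An orderly bipartite forest is a simple graph $F$ with no cycle such that $\min E<\max E'$ for every two edges $E,E'$ of $F$ (equivalently, its vertex set splits as $A\cup B$ with $A<B$ and every edge joins $A$ and $B$). An orderly bipartite forest with singletons is a hypergraph $F=F_1\cup F_2$ where $F_1$ is an orderly bipartite forest and $F_2$ consists of (possibly repeated) one-element edges. A function $f$ is nearly linear if $n^{1-\varepsilon}\ll f(n)\ll n^{1+\varepsilon}$ for every $\varepsilon>0$. $f\gg g$ means $g\ll f$, where $f\ll g$ means $|f(n)|<c|g(n)|$ for a constant $c>0$ and all large $n$. -}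

module Defs where

open import Data.Nat using (ℕ; _<_; _≤_; _≟_)
open import Data.Fin using (Fin)
open import Data.List using (List; []; _∷_; _++_; length; lookup; concatMap; deduplicate)
open import Data.List.Membership.Propositional using (_∈_)
open import Data.List.Relation.Unary.Linked using (Linked)
open import Data.List.Relation.Unary.All using (All)
open import Data.List.Relation.Unary.Unique.Propositional using (Unique)
open import Data.List.Relation.Binary.Permutation.Propositional using (_↭_)
open import Data.List.Relation.Unary.Any using (Any)
open import Data.Product using (Σ; ∃; ∃-syntax; _×_)
open import Data.Sum using (_⊎_)
open import Relation.Binary.PropositionalEquality using (_≡_)
open import Relation.Nullary using (¬_)
open import Function.Definitions using (Injective)

-- An edge: a finite nonempty subset of ℕ, represented canonically as a
-- strictly increasing nonempty list of its elements.
record Edge : Set where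
  constructor mkEdge
  field
    elems    : List ℕ
    sorted   : Linked _<_ elems
    nonempty : ¬ (elems ≡ [])
open Edge public

-- A hypergraph: a finite list of edges (repetitions allowed), indexed by
-- Fin (length H).
Hypergraph : Set
Hypergraph = List Edge

e : Hypergraph → ℕ
e H = length H

vertexList : Hypergraph → List ℕ
vertexList H = concatMap elems H

v : Hypergraph → ℕ
v H = length (deduplicate _≟_ (vertexList H))

Simple : Hypergraph → Set
Simple H = Unique (Data.List.map elems H)
  where import Data.List

-- H ≻ H' : increasing injection φ : ⋃H' → ⋃H and injection f : I' → I
-- with v ∈ E'_i ⇒ φ(v) ∈ E_{f(i)}.  (φ is given as a function on ℕ; only its
-- values on ⋃H' matter, and these lie in ⋃H automatically.)
_≻_ : Hypergraph → Hypergraph → Set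
H ≻ H' =
  Σ (ℕ → ℕ) λ φ →
    ((x y : ℕ) → x ∈ vertexList H' → y ∈ vertexList H' → x < y → φ x < φ y) ×
  Σ (Fin (length H') → Fin (length H)) λ f →
    Injective _≡_ _≡_ f ×
    ((i : Fin (length H')) (x : ℕ) → x ∈ elems (lookup H' i) →
       φ x ∈ elems (lookup H (f i)))

Adj : Hypergraph → ℕ → ℕ → Set
Adj G x y = Any (λ E → elems E ≡ x ∷ y ∷ [] ⊎ elems E ≡ y ∷ x ∷ []) G

-- a cycle: distinct vertices u, m₁, …, m_k, w (k ≥ 1, so length ≥ 3),
-- consecutive ones adjacent, and w adjacent to u
HasCycle : Hypergraph → Set
HasCycle G =
  ∃[ u ] ∃[ mid ] ∃[ w ]
    Unique (u ∷ mid ++ w ∷ []) × 1 ≤ length mid ×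
    Linked (Adj G) (u ∷ mid ++ w ∷ []) × Adj G w u

IsGraph : Hypergraph → Set
IsGraph G = All (λ E → ∃[ a ] ∃[ b ] (elems E ≡ a ∷ b ∷ [])) G

-- orderly: min E < max E' for all edges E, E' (edges are sorted 2-lists)
Orderly : Hypergraph → Set
Orderly G = ∀ {E E'} → E ∈ G → E' ∈ G → ∀ {a b c d} →
  elems E ≡ a ∷ b ∷ [] → elems E' ≡ c ∷ d ∷ [] → a < d

OrderlyBipartiteForest : Hypergraph → Set
OrderlyBipartiteForest G = IsGraph G × Simple G × ¬ HasCycle G × Orderly G

Singletons : Hypergraph → Set
Singletons G = All (λ E → ∃[ a ] (elems E ≡ a ∷ [])) G

OrderlyBipartiteForestWithSingletons : Hypergraph → Set
OrderlyBipartiteForestWithSingletons F =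
  ∃[ F₁ ] ∃[ F₂ ] (F ↭ (F₁ ++ F₂)) × OrderlyBipartiteForest F₁ × Singletons F₂

{-# OPTIONS --safe #-}

-- Let r exceed the number of vertices of F. For n ≥ 4·2^r let K = ⌊n/4⌋ and pick d ≥ 1 with
-- (d+1)^r ≤ K < (d+2)^r. Scan the pairs (x, y) ∈ [0, 2K) × [2K, 4K) once, adding the edge xy
-- whenever x and y both have degree below d and y is not within distance r of x. The resulting
-- graph H is simple, has maximum degree d and no cycle on at most r + 1 vertices. It is also
-- saturated: if some y still has degree below d, every x outside the r-ball of y (at most
-- (d+1)^r ≤ K vertices) has degree d, so e(H) ≥ dK/2, which is of order n^(1+1/r).
-- Suppose H ≻ F via an increasing φ. Each edge of F lands inside a two-element edge of H, so it
-- has at most two vertices, and a two-element edge {a < b} goes onto {φ a < φ b}. Hence the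
-- two-element edges of F are distinct (H is simple), orderly (each edge of H runs from [0, 2K)
-- to [2K, 4K)) and acyclic (a cycle would map to a cycle of H on at most r vertices): F would be
-- an orderly bipartite forest with singletons.

module Submission where

open import Defs
open import Data.Nat using (ℕ; _<_; _≤_; _*_; _^_)
open import Data.Product using (Σ; ∃; ∃-syntax; _×_)
open import Relation.Nullary using (¬_)

open import Data.Nat
  using (zero; suc; _+_; z≤n; s≤s; _≟_; _<?_; _≤?_; NonZero; >-nonZero; >-nonZero⁻¹)
open import Data.Nat.Properties
open import Data.Nat.DivMod using (_/_; _%_; m≡m%n+[m/n]*n; m%n<n; m/n*n≤m; m*n/n≡m; /-monoˡ-≤)
open import Data.Nat.ListAction using (sum)
open import Data.Nat.Tactic.RingSolver using (solve-∀)
open import Data.Fin using (Fin)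
open import Data.List using
  (List; []; _∷_; _++_; length; map; concatMap; lookup; upTo; applyUpTo; cartesianProduct; filter; foldl)
open import Data.List.Properties using
  ( length-++; length-map; map-++; length-upTo; length-applyUpTo; length-++-≤ˡ; tabulate-lookup
  ; ++-assoc; ∷-injectiveˡ; partition-defn)
open import Data.List.Membership.Propositional using (_∈_; _∉_; find)
open import Data.List.Membership.Propositional.Properties using
  ( ∈-++⁺ˡ; ∈-++⁺ʳ; ∈-++⁻; ∈-∃++; ∈-concatMap⁺; ∈-concatMap⁻; ∈-map⁺; ∈-lookup; ∈-upTo⁺; ∈-upTo⁻
  ; ∈-applyUpTo⁻; ∈-cartesianProduct⁺; ∈-deduplicate⁻; ∈-filter⁻)
open import Data.List.Membership.DecPropositional _≟_ using (_∈?_)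
open import Data.List.Relation.Unary.Any as Any using (Any; here; there; index; any?)
open import Data.List.Relation.Unary.Any.Properties using (lookup-index; ++⁺ʳ)
open import Data.List.Relation.Unary.All as All using (All; []; _∷_)
open import Data.List.Relation.Unary.All.Properties
  using (All¬⇒¬Any; ¬Any⇒All¬; all-filter) renaming (map⁺ to All-map⁺)
open import Data.List.Relation.Unary.AllPairs as AllPairs using (AllPairs; []; _∷_)
import Data.List.Relation.Unary.AllPairs.Properties as AllPairsₚ
open import Data.List.Relation.Unary.Unique.Propositional using (Unique)
open import Data.List.Relation.Unary.Unique.Propositional.Properties using (upTo⁺; applyUpTo⁺₁)
open import Data.List.Relation.Unary.Unique.DecPropositional.Properties using (deduplicate-!)
open import Data.List.Relation.Unary.Linked as Linked using (Linked; []; [-]; _∷_)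
import Data.List.Relation.Unary.Linked.Properties as Linkedₚ
open import Data.List.Relation.Binary.Permutation.Propositional using (_↭_; ↭ₛ⇒↭)
open import Data.List.Relation.Binary.Permutation.Setoid.Properties using (partition-↭)
open import Data.Product using (_,_; proj₁; proj₂)
open import Data.Sum using (_⊎_; inj₁; inj₂)
open import Data.Empty using (⊥; ⊥-elim)
open import Function using (_∘_)
open import Function.Definitions using (Injective)
open import Relation.Nullary using (Dec; yes; no; ¬?)
open import Relation.Nullary.Decidable using (_×-dec_)
open import Relation.Unary.Properties using (∁?)
open import Relation.Binary.Definitions using (tri<; tri≈; tri>)
open import Relation.Binary.PropositionalEquality

module _ {A : Set} where

  remove-∈ : ∀ {x : A} {ys} → x ∈ ys →
    ∃[ zs ] (length ys ≡ suc (length zs) × (∀ {z} → z ∈ ys → z ≢ x → z ∈ zs))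
  remove-∈ {x} x∈ys with ys₁ , ys₂ , refl ← ∈-∃++ x∈ys = ys₁ ++ ys₂ , length-eq , keep
    where
    length-eq : length (ys₁ ++ x ∷ ys₂) ≡ suc (length (ys₁ ++ ys₂))
    length-eq = trans (length-++ ys₁) (trans (+-suc _ _) (cong suc (sym (length-++ ys₁))))
    keep : ∀ {z} → z ∈ ys₁ ++ x ∷ ys₂ → z ≢ x → z ∈ ys₁ ++ ys₂
    keep z∈ z≢x with ∈-++⁻ ys₁ z∈
    ... | inj₁ z∈ys₁ = ∈-++⁺ˡ z∈ys₁
    ... | inj₂ (here z≡x) = ⊥-elim (z≢x z≡x)
    ... | inj₂ (there z∈ys₂) = ∈-++⁺ʳ ys₁ z∈ys₂

  pigeonhole : {xs ys : List A} → Unique xs → All (_∈ ys) xs → length xs ≤ length ys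
  pigeonhole [] [] = z≤n
  pigeonhole (x∉xs ∷ xs-unique) (x∈ys ∷ xs⊆ys) with zs , ys≡ , keep ← remove-∈ x∈ys =
    subst (_ ≤_) (sym ys≡) (s≤s (pigeonhole xs-unique
      (All.zipWith (λ (x≢z , z∈ys) → keep z∈ys (≢-sym x≢z)) (x∉xs , xs⊆ys))))

  sum-map-lowerBound : (w : A → ℕ) (d : ℕ) {xs ys : List A} → Unique xs →
    All (λ x → d ≤ w x ⊎ x ∈ ys) xs → d * length xs ≤ sum (map w xs) + d * length ys
  sum-map-lowerBound w d [] [] = ≤-trans (≤-reflexive (*-zeroʳ d)) z≤n
  sum-map-lowerBound w d {x ∷ xs} {ys} (_ ∷ xs-unique) (inj₁ d≤wx ∷ rest) = begin
    d * suc (length xs)                       ≡⟨ *-suc d (length xs) ⟩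
    d + d * length xs                         ≤⟨ +-mono-≤ d≤wx (sum-map-lowerBound w d xs-unique rest) ⟩
    w x + (sum (map w xs) + d * length ys)    ≡⟨ +-assoc (w x) _ _ ⟨
    w x + sum (map w xs) + d * length ys      ∎
    where open ≤-Reasoning
  sum-map-lowerBound w d {x ∷ xs} {ys} (x∉xs ∷ xs-unique) (inj₂ x∈ys ∷ rest)
    with zs , ys≡ , keep ← remove-∈ x∈ys = begin
    d * suc (length xs)                       ≡⟨ *-suc d (length xs) ⟩
    d + d * length xs
      ≤⟨ +-monoʳ-≤ d (sum-map-lowerBound w d xs-unique (rest′ x∉xs rest)) ⟩
    d + (sum (map w xs) + d * length zs)      ≡⟨ shuffle d (sum (map w xs)) (length zs) ⟩
    sum (map w xs) + d * suc (length zs)      ≤⟨ +-monoˡ-≤ _ (m≤n+m (sum (map w xs)) (w x)) ⟩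
    w x + sum (map w xs) + d * suc (length zs)
      ≡⟨ cong (λ k → w x + sum (map w xs) + d * k) ys≡ ⟨
    w x + sum (map w xs) + d * length ys      ∎
    where
    open ≤-Reasoning
    shuffle : ∀ d s k → d + (s + d * k) ≡ s + d * suc k
    shuffle = solve-∀
    rest′ : ∀ {xs} → All (x ≢_) xs →
      All (λ z → d ≤ w z ⊎ z ∈ ys) xs → All (λ z → d ≤ w z ⊎ z ∈ zs) xs
    rest′ [] [] = []
    rest′ (_ ∷ x≢) (inj₁ d≤wz ∷ rest) = inj₁ d≤wz ∷ rest′ x≢ rest
    rest′ (x≢z ∷ x≢) (inj₂ z∈ys ∷ rest) = inj₂ (keep z∈ys (≢-sym x≢z)) ∷ rest′ x≢ rest

  sum-map-zero : (xs : List A) → sum (map (λ _ → 0) xs) ≡ 0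
  sum-map-zero [] = refl
  sum-map-zero (_ ∷ xs) = sum-map-zero xs

  sum-map-+ : (f g h : A → ℕ) (xs : List A) → (∀ x → h x ≡ f x + g x) →
    sum (map h xs) ≡ sum (map f xs) + sum (map g xs)
  sum-map-+ f g h [] h≗f+g = refl
  sum-map-+ f g h (x ∷ xs) h≗f+g
    rewrite h≗f+g x | sum-map-+ f g h xs h≗f+g = interchange (f x) (g x) _ _
    where
    interchange : ∀ a b c d → (a + b) + (c + d) ≡ (a + c) + (b + d)
    interchange = solve-∀

  length-concatMap-≤ : (f : A → List ℕ) (xs : List A) {b : ℕ} → (∀ x → length (f x) ≤ b) →
    length (concatMap f xs) ≤ length xs * b
  length-concatMap-≤ f [] f≤b = z≤n
  length-concatMap-≤ f (x ∷ xs) f≤b =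
    ≤-trans (≤-reflexive (length-++ (f x))) (+-mono-≤ (f≤b x) (length-concatMap-≤ f xs f≤b))

  AllPairs-restrict : ∀ {P : A → Set} {R : A → A → Set} {xs} → All P xs →
    AllPairs (λ x y → P x → P y → R x y) xs → AllPairs R xs
  AllPairs-restrict [] [] = []
  AllPairs-restrict (px ∷ pxs) (rx ∷ rxs) =
    All.zipWith (λ (py , r) → r px py) (pxs , rx) ∷ AllPairs-restrict pxs rxs

lookup-injective : ∀ {A B : Set} {g : A → B} (xs : List A) → Unique (map g xs) →
  ∀ {i j} → g (lookup xs i) ≡ g (lookup xs j) → i ≡ j
lookup-injective (x ∷ xs) _ {Fin.zero} {Fin.zero} _ = refl
lookup-injective {g = g} (x ∷ xs) (x∉ ∷ _) {Fin.zero} {Fin.suc j} eq =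
  ⊥-elim (All.lookup x∉ (∈-map⁺ g (∈-lookup j)) eq)
lookup-injective {g = g} (x ∷ xs) (x∉ ∷ _) {Fin.suc i} {Fin.zero} eq =
  ⊥-elim (All.lookup x∉ (∈-map⁺ g (∈-lookup i)) (sym eq))
lookup-injective (x ∷ xs) (_ ∷ unique) {Fin.suc i} {Fin.suc j} eq =
  cong Fin.suc (lookup-injective xs unique eq)

∈-vertexList : ∀ {G : Hypergraph} {E x} → E ∈ G → x ∈ elems E → x ∈ vertexList G
∈-vertexList E∈G x∈E = ∈-concatMap⁺ elems (Any.map (λ { refl → x∈E }) E∈G)

∈⇒Adj : ∀ {G : Hypergraph} {E x y} → E ∈ G → elems E ≡ x ∷ y ∷ [] → Adj G x y
∈⇒Adj E∈G E≡xy = Any.map (λ { refl → inj₁ E≡xy }) E∈G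

Adj-sym : ∀ {G x y} → Adj G x y → Adj G y x
Adj-sym = Any.map λ { (inj₁ eq) → inj₂ eq ; (inj₂ eq) → inj₁ eq }

data Walk (G : Hypergraph) : ℕ → ℕ → ℕ → Set where
  [] : ∀ {a} → Walk G 0 a a
  _∷_ : ∀ {k a b c} → Adj G a b → Walk G k b c → Walk G (suc k) a c

module _ {G : Hypergraph} where

  _∷ʳ_ : ∀ {k a b c} → Walk G k a b → Adj G b c → Walk G (suc k) a c
  [] ∷ʳ e = e ∷ []
  (e′ ∷ w) ∷ʳ e = e′ ∷ (w ∷ʳ e)

  reverseʷ : ∀ {k a b} → Walk G k a b → Walk G k b a
  reverseʷ [] = []
  reverseʷ (e ∷ w) = reverseʷ w ∷ʳ Adj-sym e

  _++ʷ_ : ∀ {k l a b c} → Walk G k a b → Walk G l b c → Walk G (k + l) a c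
  [] ++ʷ w′ = w′
  (e ∷ w) ++ʷ w′ = e ∷ (w ++ʷ w′)

  Linked⇒Walk : ∀ {a} ℓ {w} → Linked (Adj G) (a ∷ ℓ ++ w ∷ []) → Walk G (suc (length ℓ)) a w
  Linked⇒Walk [] (e ∷ [-]) = e ∷ []
  Linked⇒Walk (b ∷ ℓ) (e ∷ linked) = e ∷ Linked⇒Walk ℓ linked

mapʷ : ∀ {G G′ k a b} → (∀ {x y} → Adj G x y → Adj G′ x y) → Walk G k a b → Walk G′ k a b
mapʷ f [] = []
mapʷ f (e ∷ w) = f e ∷ mapʷ f w

hop : ℕ → ℕ → ℕ → List ℕ
hop z a b with z ≟ a
... | yes _ = b ∷ []
... | no _ = []

edgeNeighbours : List ℕ → ℕ → List ℕ
edgeNeighbours (a ∷ b ∷ []) z = hop z a b ++ hop z b a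
edgeNeighbours _ z = []

neighbours : Hypergraph → ℕ → List ℕ
neighbours G z = concatMap (λ E → edgeNeighbours (elems E) z) G

deg : Hypergraph → ℕ → ℕ
deg G z = length (neighbours G z)

∈-hop⁺ : ∀ a b → b ∈ hop a a b
∈-hop⁺ a b with a ≟ a
... | yes _ = here refl
... | no a≢a = ⊥-elim (a≢a refl)

∈-hop⁻ : ∀ {z a b c} → c ∈ hop z a b → z ≡ a × c ≡ b
∈-hop⁻ {z} {a} c∈ with z ≟ a
∈-hop⁻ (here refl) | yes z≡a = z≡a , refl

Adj⇒∈neighbours : ∀ {G a b} → Adj G a b → b ∈ neighbours G a
Adj⇒∈neighbours {E ∷ G} {a} {b} (here (inj₁ E≡ab)) rewrite E≡ab =
  ∈-++⁺ˡ (∈-++⁺ˡ (∈-hop⁺ a b))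
Adj⇒∈neighbours {E ∷ G} {a} {b} (here (inj₂ E≡ba)) rewrite E≡ba =
  ∈-++⁺ˡ (∈-++⁺ʳ (hop a b a) (∈-hop⁺ a b))
Adj⇒∈neighbours {E ∷ G} (there adj) = ∈-++⁺ʳ (edgeNeighbours (elems E) _) (Adj⇒∈neighbours adj)

∈neighbours⇒Adj : ∀ {G a b} → b ∈ neighbours G a → Adj G a b
∈neighbours⇒Adj {E ∷ G} {a} b∈ with ∈-++⁻ (edgeNeighbours (elems E) a) b∈
... | inj₂ b∈rest = there (∈neighbours⇒Adj b∈rest)
... | inj₁ b∈E = here (∈edgeNeighbours⇒ (elems E) b∈E)
  where
  ∈edgeNeighbours⇒ : ∀ xs {a b} → b ∈ edgeNeighbours xs a →
    xs ≡ a ∷ b ∷ [] ⊎ xs ≡ b ∷ a ∷ []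
  ∈edgeNeighbours⇒ (p ∷ q ∷ []) {a} b∈ with ∈-++⁻ (hop a p q) b∈
  ... | inj₁ b∈pq with refl , refl ← ∈-hop⁻ b∈pq = inj₁ refl
  ... | inj₂ b∈qp with refl , refl ← ∈-hop⁻ b∈qp = inj₂ refl

sum-hop≤1 : ∀ a b {zs} → Unique zs → sum (map (λ z → length (hop z a b)) zs) ≤ 1
sum-hop≤1 a b [] = z≤n
sum-hop≤1 a b {z ∷ zs} (z∉zs ∷ zs-unique) with z ≟ a
... | yes refl = s≤s (≤-reflexive (sum-hop-absent zs (All¬⇒¬Any z∉zs)))
  where
  sum-hop-absent : ∀ zs → z ∉ zs → sum (map (λ z′ → length (hop z′ z b)) zs) ≡ 0
  sum-hop-absent [] _ = refl
  sum-hop-absent (z′ ∷ zs) z∉ with z′ ≟ z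
  ... | yes refl = ⊥-elim (z∉ (here refl))
  ... | no _ = sum-hop-absent zs (z∉ ∘ there)
... | no _ = sum-hop≤1 a b zs-unique

sum-edgeNeighbours≤2 : ∀ xs {zs} → Unique zs →
  sum (map (λ z → length (edgeNeighbours xs z)) zs) ≤ 2
sum-edgeNeighbours≤2 (a ∷ b ∷ []) {zs} zs-unique =
  ≤-trans (≤-reflexive (sum-map-+ _ _ _ zs (λ z → length-++ (hop z a b))))
    (+-mono-≤ (sum-hop≤1 a b zs-unique) (sum-hop≤1 b a zs-unique))
sum-edgeNeighbours≤2 [] {zs} _ = ≤-trans (≤-reflexive (sum-map-zero zs)) z≤n
sum-edgeNeighbours≤2 (a ∷ []) {zs} _ = ≤-trans (≤-reflexive (sum-map-zero zs)) z≤n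
sum-edgeNeighbours≤2 (a ∷ b ∷ c ∷ xs) {zs} _ = ≤-trans (≤-reflexive (sum-map-zero zs)) z≤n

sum-deg≤2*e : ∀ G {zs} → Unique zs → sum (map (deg G) zs) ≤ 2 * e G
sum-deg≤2*e [] {zs} _ = ≤-reflexive (sum-map-zero zs)
sum-deg≤2*e (E ∷ G) {zs} zs-unique = begin
  sum (map (deg (E ∷ G)) zs)
    ≡⟨ sum-map-+ _ _ _ zs (λ z → length-++ (edgeNeighbours (elems E) z)) ⟩
  sum (map (λ z → length (edgeNeighbours (elems E) z)) zs) + sum (map (deg G) zs)
    ≤⟨ +-mono-≤ (sum-edgeNeighbours≤2 (elems E) zs-unique) (sum-deg≤2*e G zs-unique) ⟩
  2 + 2 * e G
    ≡⟨ *-suc 2 (e G) ⟨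
  2 * e (E ∷ G) ∎
  where open ≤-Reasoning

deg-++ʳ : ∀ G′ G z → deg G z ≤ deg (G′ ++ G) z
deg-++ʳ [] G z = ≤-refl
deg-++ʳ (E ∷ G′) G z = begin
  deg G z                                                ≤⟨ deg-++ʳ G′ G z ⟩
  deg (G′ ++ G) z                                        ≤⟨ m≤n+m _ _ ⟩
  length (edgeNeighbours (elems E) z) + deg (G′ ++ G) z  ≡⟨ length-++ (edgeNeighbours (elems E) z) ⟨
  deg (E ∷ G′ ++ G) z                                    ∎
  where open ≤-Reasoning

ball : Hypergraph → ℕ → ℕ → List ℕ
ball G zero a = a ∷ []
ball G (suc k) a = a ∷ concatMap (ball G k) (neighbours G a)

Walk⇒∈ball : ∀ {G j a b} k → Walk G j a b → j ≤ k → b ∈ ball G k a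
Walk⇒∈ball zero [] _ = here refl
Walk⇒∈ball (suc k) [] _ = here refl
Walk⇒∈ball {G} (suc k) (e ∷ w) (s≤s j≤k) =
  there (∈-concatMap⁺ (ball G k)
    (Any.map (λ { refl → Walk⇒∈ball k w j≤k }) (Adj⇒∈neighbours e)))

∈ball⇒Walk : ∀ {G a b} k → b ∈ ball G k a → ∃[ j ] (j ≤ k × Walk G j a b)
∈ball⇒Walk zero (here refl) = 0 , z≤n , []
∈ball⇒Walk (suc k) (here refl) = 0 , z≤n , []
∈ball⇒Walk {G} {a} (suc k) (there b∈) with find (∈-concatMap⁻ (ball G k) {neighbours G a} b∈)
... | c , c∈ , b∈ball-c with j , j≤k , w ← ∈ball⇒Walk k b∈ball-c =
  suc j , s≤s j≤k , ∈neighbours⇒Adj c∈ ∷ w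

ball-sym : ∀ {G a b} k → b ∈ ball G k a → a ∈ ball G k b
ball-sym k b∈ with j , j≤k , w ← ∈ball⇒Walk k b∈ = Walk⇒∈ball k (reverseʷ w) j≤k

ball-++ʳ : ∀ G′ {G a b} k → b ∈ ball G k a → b ∈ ball (G′ ++ G) k a
ball-++ʳ G′ k b∈ with j , j≤k , w ← ∈ball⇒Walk k b∈ = Walk⇒∈ball k (mapʷ (++⁺ʳ G′) w) j≤k

length-ball : ∀ {G d} → (∀ z → deg G z ≤ d) → ∀ k a → length (ball G k a) ≤ suc d ^ k
length-ball deg≤d zero a = ≤-refl
length-ball {G} {d} deg≤d (suc k) a = begin
  suc (length (concatMap (ball G k) (neighbours G a)))
    ≤⟨ s≤s (length-concatMap-≤ (ball G k) (neighbours G a) (length-ball deg≤d k)) ⟩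
  suc (deg G a * suc d ^ k)    ≤⟨ s≤s (*-monoˡ-≤ _ (deg≤d a)) ⟩
  suc (d * suc d ^ k)          ≤⟨ +-monoˡ-≤ _ (m^n>0 (suc d) k) ⟩
  suc d ^ k + d * suc d ^ k    ∎
  where open ≤-Reasoning

IsCycle : Hypergraph → ℕ → List ℕ → ℕ → Set
IsCycle G u mid w =
  Unique (u ∷ mid ++ w ∷ []) × 1 ≤ length mid × Linked (Adj G) (u ∷ mid ++ w ∷ []) × Adj G w u

-- no cycle on at most r + 1 vertices
ShortCycleFree : ℕ → Hypergraph → Set
ShortCycleFree r G = ∀ {u mid w} → length mid < r → ¬ IsCycle G u mid w

pairEdge : (x y : ℕ) → x < y → Edge
pairEdge x y x<y = mkEdge (x ∷ y ∷ []) (x<y ∷ [-]) (λ ())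

module _ {G : Hypergraph} {x y : ℕ} (x<y : x < y) where

  private
    G⁺ : Hypergraph
    G⁺ = pairEdge x y x<y ∷ G

    Joins : ℕ → ℕ → Set
    Joins s t = (s ≡ x × t ≡ y) ⊎ (s ≡ y × t ≡ x)

  Linked-avoiding : ∀ {a} ℓ → a ≡ x ⊎ a ≡ y → a ∉ ℓ → Linked (Adj G⁺) ℓ → Linked (Adj G) ℓ
  Linked-avoiding [] _ _ _ = []
  Linked-avoiding (b ∷ []) _ _ _ = [-]
  Linked-avoiding (b ∷ c ∷ ℓ) a∈xy a∉ (there e ∷ linked) =
    e ∷ Linked-avoiding (c ∷ ℓ) a∈xy (a∉ ∘ there) linked
  Linked-avoiding (b ∷ c ∷ ℓ) (inj₁ refl) a∉ (here (inj₁ refl) ∷ _) = ⊥-elim (a∉ (here refl))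
  Linked-avoiding (b ∷ c ∷ ℓ) (inj₂ refl) a∉ (here (inj₁ refl) ∷ _) = ⊥-elim (a∉ (there (here refl)))
  Linked-avoiding (b ∷ c ∷ ℓ) (inj₁ refl) a∉ (here (inj₂ refl) ∷ _) = ⊥-elim (a∉ (there (here refl)))
  Linked-avoiding (b ∷ c ∷ ℓ) (inj₂ refl) a∉ (here (inj₂ refl) ∷ _) = ⊥-elim (a∉ (here refl))

  -- The vertices being distinct, the new edge occurs at most once on the path.
  Linked-split : ∀ a ℓ {w} → Unique (a ∷ ℓ ++ w ∷ []) → Linked (Adj G⁺) (a ∷ ℓ ++ w ∷ []) →
    Linked (Adj G) (a ∷ ℓ ++ w ∷ []) ⊎
    ∃[ s ] ∃[ t ] ∃[ k₁ ] ∃[ k₂ ]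
      (Joins s t × Walk G k₁ a s × Walk G k₂ t w × k₁ + suc k₂ ≡ suc (length ℓ))
  Linked-split a [] _ (there e ∷ [-]) = inj₁ (e ∷ [-])
  Linked-split a [] _ (here (inj₁ refl) ∷ [-]) =
    inj₂ (x , y , 0 , 0 , inj₁ (refl , refl) , [] , [] , refl)
  Linked-split a [] _ (here (inj₂ refl) ∷ [-]) =
    inj₂ (y , x , 0 , 0 , inj₂ (refl , refl) , [] , [] , refl)
  Linked-split a (b ∷ ℓ) (_ ∷ unique) (there e ∷ linked) with Linked-split b ℓ unique linked
  ... | inj₁ linkedG = inj₁ (e ∷ linkedG)
  ... | inj₂ (s , t , k₁ , k₂ , st , a→s , t→w , k≡) =
    inj₂ (s , t , suc k₁ , k₂ , st , e ∷ a→s , t→w , cong suc k≡)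
  Linked-split a (b ∷ ℓ) (a∉ ∷ _) (here (inj₁ refl) ∷ linked) =
    inj₂ (a , b , 0 , suc (length ℓ) , inj₁ (refl , refl) , [] ,
          Linked⇒Walk ℓ (Linked-avoiding (b ∷ ℓ ++ _ ∷ []) (inj₁ refl) (All¬⇒¬Any a∉) linked) ,
          refl)
  Linked-split a (b ∷ ℓ) (a∉ ∷ _) (here (inj₂ refl) ∷ linked) =
    inj₂ (a , b , 0 , suc (length ℓ) , inj₂ (refl , refl) , [] ,
          Linked⇒Walk ℓ (Linked-avoiding (b ∷ ℓ ++ _ ∷ []) (inj₂ refl) (All¬⇒¬Any a∉) linked) ,
          refl)

  private
    far-apart : ∀ {r k s t} → (∀ {k} → k ≤ r → ¬ Walk G k x y) →
      k ≤ r → Joins s t → ¬ Walk G k s t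
    far-apart far k≤r (inj₁ (refl , refl)) = far k≤r
    far-apart far k≤r (inj₂ (refl , refl)) = far k≤r ∘ reverseʷ

  -- A short cycle through the new edge would leave a short walk from x to y in G.
  ShortCycleFree-∷ : ∀ {r} → (∀ {k} → k ≤ r → ¬ Walk G k x y) →
    ShortCycleFree r G → ShortCycleFree r G⁺
  ShortCycleFree-∷ {r} far free {u} {mid} {w} mid<r (unique , 1≤mid , linked , there wu)
    with Linked-split u mid unique linked
  ... | inj₁ linkedG = free mid<r (unique , 1≤mid , linkedG , wu)
  ... | inj₂ (s , t , k₁ , k₂ , st , u→s , t→w , k≡) =
    far-apart far bound (flip st) (t→w ++ʷ (wu ∷ u→s))
    where
    flip : Joins s t → Joins t s
    flip (inj₁ (s≡x , t≡y)) = inj₂ (t≡y , s≡x)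
    flip (inj₂ (s≡y , t≡x)) = inj₁ (t≡x , s≡y)
    +-suc-comm : ∀ a b → a + suc b ≡ b + suc a
    +-suc-comm = solve-∀
    bound : k₂ + suc k₁ ≤ r
    bound = subst (_≤ r) (trans (sym k≡) (+-suc-comm k₁ k₂)) mid<r
  ShortCycleFree-∷ {r} far free {u} {m₁ ∷ mid} {w} mid<r
    (u∉ ∷ m₁∉ ∷ _ , _ , u-m₁ ∷ linked , here wu) = closing wu u-m₁
    where
    u∈xy : x ∷ y ∷ [] ≡ w ∷ u ∷ [] ⊎ x ∷ y ∷ [] ≡ u ∷ w ∷ [] → u ≡ x ⊎ u ≡ y
    u∈xy (inj₁ refl) = inj₂ refl
    u∈xy (inj₂ refl) = inj₁ refl
    u→w : Adj G u m₁ → Walk G (suc (suc (length mid))) u w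
    u→w e =
      e ∷ Linked⇒Walk mid (Linked-avoiding (m₁ ∷ mid ++ w ∷ []) (u∈xy wu) (All¬⇒¬Any u∉) linked)
    w∈ : w ∈ mid ++ w ∷ []
    w∈ = ∈-++⁺ʳ mid (here refl)
    closing : x ∷ y ∷ [] ≡ w ∷ u ∷ [] ⊎ x ∷ y ∷ [] ≡ u ∷ w ∷ [] → Adj G⁺ u m₁ → ⊥
    closing (inj₁ refl) (there e) = far mid<r (reverseʷ (u→w e))
    closing (inj₂ refl) (there e) = far mid<r (u→w e)
    closing (inj₁ refl) (here (inj₁ refl)) = <-irrefl refl x<y
    closing (inj₁ refl) (here (inj₂ refl)) = All¬⇒¬Any m₁∉ w∈
    closing (inj₂ refl) (here (inj₁ refl)) = All¬⇒¬Any m₁∉ w∈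
    closing (inj₂ refl) (here (inj₂ refl)) = <-irrefl refl x<y

Crosses : ℕ → Edge → Set
Crosses m E = ∃[ a ] ∃[ b ] (elems E ≡ a ∷ b ∷ [] × a < m × m ≤ b)

module Greedy (m d r : ℕ) .{{_ : NonZero r}} where

  Admissible : Hypergraph → ℕ × ℕ → Set
  Admissible G (x , y) =
    x < m × m ≤ y × y < m + m × deg G x < d × deg G y < d × y ∉ ball G r x

  admissible? : ∀ G p → Dec (Admissible G p)
  admissible? G (x , y) = x <? m ×-dec m ≤? y ×-dec y <? m + m ×-dec
    deg G x <? d ×-dec deg G y <? d ×-dec ¬? (y ∈? ball G r x)

  extend : Hypergraph → ℕ × ℕ → Hypergraph
  extend G (x , y) with admissible? G (x , y)
  ... | yes (x<m , m≤y , _) = pairEdge x y (<-≤-trans x<m m≤y) ∷ G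
  ... | no _ = G

  greedy : Hypergraph → List (ℕ × ℕ) → Hypergraph
  greedy = foldl extend

  record Invariant (G : Hypergraph) : Set where
    field
      crossing : All (Crosses m) G
      bounded : ∀ {z} → z ∈ vertexList G → z < m + m
      deg≤d : ∀ z → deg G z ≤ d
      shortCycleFree : ShortCycleFree r G
      simple : Simple G

  invariant-[] : Invariant []
  invariant-[] = record
    { crossing = [] ; bounded = λ () ; deg≤d = λ _ → z≤n
    ; shortCycleFree = λ { _ (_ , _ , _ , ()) } ; simple = [] }

  extend-invariant : ∀ G p → Invariant G → Invariant (extend G p)
  extend-invariant G (x , y) inv with admissible? G (x , y)
  ... | no _ = inv
  ... | yes (x<m , m≤y , y<2m , degx<d , degy<d , y∉ball) = record
    { crossing = (x , y , refl , x<m , m≤y) ∷ crossing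
    ; bounded = bounded⁺
    ; deg≤d = deg⁺
    ; shortCycleFree = ShortCycleFree-∷ x<y far shortCycleFree
    ; simple = All-map⁺ (All.tabulate fresh) ∷ simple
    }
    where
    open Invariant inv
    x<y : x < y
    x<y = <-≤-trans x<m m≤y
    far : ∀ {k} → k ≤ r → ¬ Walk G k x y
    far k≤r w = y∉ball (Walk⇒∈ball r w k≤r)
    fresh : ∀ {E} → E ∈ G → x ∷ y ∷ [] ≢ elems E
    fresh E∈G xy≡E = far (>-nonZero⁻¹ r) (∈⇒Adj E∈G (sym xy≡E) ∷ [])
    bounded⁺ : ∀ {z} → z ∈ x ∷ y ∷ vertexList G → z < m + m
    bounded⁺ (here refl) = <-≤-trans x<m (m≤m+n m m)
    bounded⁺ (there (here refl)) = y<2m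
    bounded⁺ (there (there z∈)) = bounded z∈
    deg⁺ : ∀ z → length ((hop z x y ++ hop z y x) ++ neighbours G z) ≤ d
    deg⁺ z with z ≟ x | z ≟ y
    ... | yes refl | yes refl = ⊥-elim (<-irrefl refl x<y)
    ... | yes refl | no _ = degx<d
    ... | no _ | yes refl = degy<d
    ... | no _ | no _ = deg≤d z

  greedy-invariant : ∀ G ps → Invariant G → Invariant (greedy G ps)
  greedy-invariant G [] inv = inv
  greedy-invariant G (p ∷ ps) inv = greedy-invariant (extend G p) ps (extend-invariant G p inv)

  extend-++ : ∀ G p → ∃[ G′ ] (extend G p ≡ G′ ++ G)
  extend-++ G (x , y) with admissible? G (x , y)
  ... | yes _ = _ ∷ [] , refl
  ... | no _ = [] , refl

  greedy-++ : ∀ G ps → ∃[ G′ ] (greedy G ps ≡ G′ ++ G)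
  greedy-++ G [] = [] , refl
  greedy-++ G (p ∷ ps) with G₁ , eq₁ ← extend-++ G p | G₂ , eq₂ ← greedy-++ (extend G p) ps =
    G₂ ++ G₁ , trans eq₂ (trans (cong (G₂ ++_) eq₁) (sym (++-assoc G₂ G₁ G)))

  Saturated : Hypergraph → ℕ × ℕ → Set
  Saturated G (x , y) = x < m → m ≤ y → y < m + m →
    d ≤ deg G x ⊎ d ≤ deg G y ⊎ y ∈ ball G r x

  Saturated-++ : ∀ G′ {G} p → Saturated G p → Saturated (G′ ++ G) p
  Saturated-++ G′ {G} (x , y) sat x<m m≤y y<2m with sat x<m m≤y y<2m
  ... | inj₁ d≤degx = inj₁ (≤-trans d≤degx (deg-++ʳ G′ G x))
  ... | inj₂ (inj₁ d≤degy) = inj₂ (inj₁ (≤-trans d≤degy (deg-++ʳ G′ G y)))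
  ... | inj₂ (inj₂ y∈ball) = inj₂ (inj₂ (ball-++ʳ G′ r y∈ball))

  extend-saturated : ∀ G p → Saturated (extend G p) p
  extend-saturated G (x , y) x<m m≤y y<2m with admissible? G (x , y)
  ... | yes _ = inj₂ (inj₂ (Walk⇒∈ball r (here (inj₁ refl) ∷ []) (>-nonZero⁻¹ r)))
  ... | no ¬admissible with deg G x <? d | deg G y <? d | y ∈? ball G r x
  ...   | no degx≮d | _ | _ = inj₁ (≮⇒≥ degx≮d)
  ...   | yes _ | no degy≮d | _ = inj₂ (inj₁ (≮⇒≥ degy≮d))
  ...   | yes _ | yes _ | yes y∈ball = inj₂ (inj₂ y∈ball)
  ...   | yes degx<d | yes degy<d | no y∉ball =
    ⊥-elim (¬admissible (x<m , m≤y , y<2m , degx<d , degy<d , y∉ball))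

  greedy-saturated : ∀ G {ps p} → p ∈ ps → Saturated (greedy G ps) p
  greedy-saturated G {p ∷ ps} (here refl) with G′ , eq ← greedy-++ (extend G p) ps =
    subst (λ G″ → Saturated G″ p) (sym eq) (Saturated-++ G′ p (extend-saturated G p))
  greedy-saturated G {q ∷ ps} (there p∈ps) = greedy-saturated (extend G q) p∈ps

  A B : List ℕ
  A = upTo m
  B = applyUpTo (m +_) m

  H : Hypergraph
  H = greedy [] (cartesianProduct A B)

  open Invariant (greedy-invariant [] (cartesianProduct A B) invariant-[]) public

  H-saturated : ∀ {x y} → x ∈ A → y ∈ B → d ≤ deg H x ⊎ d ≤ deg H y ⊎ y ∈ ball H r x
  H-saturated x∈A y∈B with i , i<m , refl ← ∈-applyUpTo⁻ (m +_) y∈B =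
    greedy-saturated [] (∈-cartesianProduct⁺ x∈A y∈B)
      (∈-upTo⁻ x∈A) (m≤m+n m i) (+-monoʳ-< m i<m)

  e-lowerBound : d * m ≤ 2 * e H + d * suc d ^ r
  e-lowerBound with any? (λ y → deg H y <? d) B
  ... | no no-low = begin
    d * m                        ≡⟨ cong (d *_) (length-applyUpTo (m +_) m) ⟨
    d * length B                 ≤⟨ sum-map-lowerBound (deg H) d {ys = []} B-unique
                                      (All.map (inj₁ ∘ ≮⇒≥) (¬Any⇒All¬ B no-low)) ⟩
    sum (map (deg H) B) + d * 0  ≤⟨ +-mono-≤ (sum-deg≤2*e H B-unique) (*-monoʳ-≤ d z≤n) ⟩
    2 * e H + d * suc d ^ r      ∎
    where
    open ≤-Reasoning
    B-unique : Unique B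
    B-unique = applyUpTo⁺₁ (m +_) m (λ i<j _ eq → <-irrefl (+-cancelˡ-≡ m _ _ eq) i<j)
  ... | yes some-low with y , y∈B , degy<d ← find some-low = begin
    d * m                                          ≡⟨ cong (d *_) (length-upTo m) ⟨
    d * length A                                   ≤⟨ sum-map-lowerBound (deg H) d (upTo⁺ m)
                                                        (All.tabulate near-or-high) ⟩
    sum (map (deg H) A) + d * length (ball H r y)  ≤⟨ +-mono-≤ (sum-deg≤2*e H (upTo⁺ m))
                                                        (*-monoʳ-≤ d (length-ball deg≤d r y)) ⟩
    2 * e H + d * suc d ^ r                        ∎
    where
    open ≤-Reasoning
    near-or-high : ∀ {x} → x ∈ A → d ≤ deg H x ⊎ x ∈ ball H r y
    near-or-high x∈A with H-saturated x∈A y∈B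
    ... | inj₁ d≤degx = inj₁ d≤degx
    ... | inj₂ (inj₁ d≤degy) = ⊥-elim (<⇒≱ degy<d d≤degy)
    ... | inj₂ (inj₂ y∈ball) = inj₂ (ball-sym r y∈ball)

  v-upperBound : v H ≤ m + m
  v-upperBound = begin
    v H                    ≤⟨ pigeonhole (deduplicate-! _≟_ (vertexList H)) (All.tabulate
                                (∈-upTo⁺ ∘ bounded ∘ ∈-deduplicate⁻ _≟_ (vertexList H))) ⟩
    length (upTo (m + m))  ≡⟨ length-upTo (m + m) ⟩
    m + m                  ∎
    where open ≤-Reasoning

high-girth-graph : ∀ r .{{_ : NonZero r}} K d → suc d ^ r ≤ K →
  ∃[ H ] (Simple H × v H ≤ K * 4 × d * K ≤ 2 * e H ×
          All (Crosses (K + K)) H × ShortCycleFree r H)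
high-girth-graph r K d [1+d]ʳ≤K = H , simple , v≤4K , dK≤2e , crossing , shortCycleFree
  where
  open Greedy (K + K) d r
  2K+2K≡4K : ∀ K → K + K + (K + K) ≡ K * 4
  2K+2K≡4K = solve-∀
  v≤4K : v H ≤ K * 4
  v≤4K = ≤-trans v-upperBound (≤-reflexive (2K+2K≡4K K))
  dK≤2e : d * K ≤ 2 * e H
  dK≤2e = +-cancelʳ-≤ (d * K) (d * K) (2 * e H) (begin
    d * K + d * K            ≡⟨ *-distribˡ-+ d K K ⟨
    d * (K + K)              ≤⟨ e-lowerBound ⟩
    2 * e H + d * suc d ^ r  ≤⟨ +-monoʳ-≤ (2 * e H) (*-monoʳ-≤ d [1+d]ʳ≤K) ⟩
    2 * e H + d * K          ∎)
    where open ≤-Reasoning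

IsPair : Edge → Set
IsPair E = ∃[ a ] ∃[ b ] (elems E ≡ a ∷ b ∷ [])

isPair? : ∀ E → Dec (IsPair E)
isPair? E with elems E
... | [] = no λ { (_ , _ , ()) }
... | _ ∷ [] = no λ { (_ , _ , ()) }
... | a ∷ b ∷ [] = yes (a , b , refl)
... | _ ∷ _ ∷ _ ∷ _ = no λ { (_ , _ , ()) }

pairs nonPairs : Hypergraph → Hypergraph
pairs = filter isPair?
nonPairs = filter (∁? isPair?)

↭-pairs++nonPairs : ∀ F → F ↭ pairs F ++ nonPairs F
↭-pairs++nonPairs F = subst (λ (P , Q) → F ↭ P ++ Q) (partition-defn isPair? F)
  (↭ₛ⇒↭ (partition-↭ (setoid Edge) isPair? F))

∈-cast : ∀ {xs ys : List ℕ} {x} → xs ≡ ys → x ∈ ys → x ∈ xs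
∈-cast xs≡ys = subst (_ ∈_) (sym xs≡ys)

elems≡⇒< : ∀ E {a b rest} → elems E ≡ a ∷ b ∷ rest → a < b
elems≡⇒< E eq = Linked.head (subst (Linked _<_) eq (sorted E))

∈-pair-ordered : ∀ {p q a b : ℕ} → p ∈ a ∷ b ∷ [] → q ∈ a ∷ b ∷ [] → p < q → a < b →
  p ≡ a × q ≡ b
∈-pair-ordered (here refl) (here refl) p<q _ = ⊥-elim (<-irrefl refl p<q)
∈-pair-ordered (here refl) (there (here refl)) _ _ = refl , refl
∈-pair-ordered (there (here refl)) (here refl) p<q a<b = ⊥-elim (<-asym p<q a<b)
∈-pair-ordered (there (here refl)) (there (here refl)) p<q _ = ⊥-elim (<-irrefl refl p<q)

module Embedding {F H : Hypergraph} {m : ℕ} (H-crosses : All (Crosses m) H)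
  (φ : ℕ → ℕ)
  (φ-mono : (x y : ℕ) → x ∈ vertexList F → y ∈ vertexList F → x < y → φ x < φ y)
  (f : Fin (length F) → Fin (length H))
  (f-edge : (i : Fin (length F)) (x : ℕ) → x ∈ elems (lookup F i) →
    φ x ∈ elems (lookup H (f i)))
  where

  F-vertex : ∀ i {x} → x ∈ elems (lookup F i) → x ∈ vertexList F
  F-vertex i = ∈-vertexList (∈-lookup {xs = F} i)

  φ-injective : ∀ {x y} → x ∈ vertexList F → y ∈ vertexList F → φ x ≡ φ y → x ≡ y
  φ-injective {x} {y} x∈ y∈ φx≡φy with <-cmp x y
  ... | tri< x<y _ _ = ⊥-elim (<-irrefl φx≡φy (φ-mono x y x∈ y∈ x<y))
  ... | tri≈ _ x≡y _ = x≡y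
  ... | tri> _ _ y<x = ⊥-elim (<-irrefl (sym φx≡φy) (φ-mono y x y∈ x∈ y<x))

  φ-reflects-< : ∀ {x y} → x ∈ vertexList F → y ∈ vertexList F → φ x < φ y → x < y
  φ-reflects-< {x} {y} x∈ y∈ φx<φy with <-cmp x y
  ... | tri< x<y _ _ = x<y
  ... | tri≈ _ refl _ = ⊥-elim (<-irrefl refl φx<φy)
  ... | tri> _ _ y<x = ⊥-elim (<-asym φx<φy (φ-mono y x y∈ x∈ y<x))

  crossing-ends : ∀ {E x y} → E ∈ H → elems E ≡ x ∷ y ∷ [] → x < m × m ≤ y
  crossing-ends E∈H E≡xy with a , b , E≡ab , a<m , m≤b ← All.lookup H-crosses E∈H
    with refl ← trans (sym E≡xy) E≡ab = a<m , m≤b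

  -- The image edge has just two vertices, and φ is increasing.
  image : ∀ i {p q} → p ∈ elems (lookup F i) → q ∈ elems (lookup F i) → p < q →
    elems (lookup H (f i)) ≡ φ p ∷ φ q ∷ []
  image i {p} {q} p∈ q∈ p<q with a , b , E≡ab , a<m , m≤b ← All.lookup H-crosses (∈-lookup (f i))
    with refl , refl ← ∈-pair-ordered
           (subst (φ p ∈_) E≡ab (f-edge i p p∈)) (subst (φ q ∈_) E≡ab (f-edge i q q∈))
           (φ-mono p q (F-vertex i p∈) (F-vertex i q∈) p<q) (<-≤-trans a<m m≤b)
    = E≡ab

  image-pair : ∀ i {a b} → elems (lookup F i) ≡ a ∷ b ∷ [] →
    elems (lookup H (f i)) ≡ φ a ∷ φ b ∷ []
  image-pair i {a} {b} eq = image i {a} {b}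
    (∈-cast eq (here refl)) (∈-cast eq (there (here refl))) (elems≡⇒< (lookup F i) eq)

  edge-size≤2 : ∀ i {a b c rest} → ¬ elems (lookup F i) ≡ a ∷ b ∷ c ∷ rest
  edge-size≤2 i {a} {b} {c} eq = <-irrefl φa≡φb (φ-mono a b (F-vertex i a∈) (F-vertex i b∈) a<b)
    where
    a∈ : a ∈ elems (lookup F i)
    a∈ = ∈-cast eq (here refl)
    b∈ : b ∈ elems (lookup F i)
    b∈ = ∈-cast eq (there (here refl))
    c∈ : c ∈ elems (lookup F i)
    c∈ = ∈-cast eq (there (there (here refl)))
    sorted-abc : Linked _<_ (a ∷ b ∷ c ∷ _)
    sorted-abc = subst (Linked _<_) eq (sorted (lookup F i))
    a<b : a < b
    a<b = Linked.head sorted-abc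
    b<c : b < c
    b<c = Linked.head (Linked.tail sorted-abc)
    φa≡φb : φ a ≡ φ b
    φa≡φb = ∷-injectiveˡ (trans (sym (image i a∈ b∈ a<b)) (image i b∈ c∈ b<c))

  at-index : ∀ {E xs} (E∈F : E ∈ F) → elems E ≡ xs → elems (lookup F (index E∈F)) ≡ xs
  at-index E∈F = subst (λ E → elems E ≡ _) (lookup-index E∈F)

  pair-Adj : ∀ {E a b} → E ∈ F → elems E ≡ a ∷ b ∷ [] →
    Adj H (φ a) (φ b) × a ∈ vertexList F × b ∈ vertexList F
  pair-Adj E∈F E≡ab =
    ∈⇒Adj (∈-lookup (f (index E∈F))) (image-pair (index E∈F) (at-index E∈F E≡ab)) ,
    ∈-vertexList E∈F (∈-cast E≡ab (here refl)) ,
    ∈-vertexList E∈F (∈-cast E≡ab (there (here refl)))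

  pairs-Adj : ∀ {p q} → Adj (pairs F) p q →
    Adj H (φ p) (φ q) × p ∈ vertexList F × q ∈ vertexList F
  pairs-Adj adj with E , E∈ , E≡ ← find adj with E∈F , _ ← ∈-filter⁻ isPair? {xs = F} E∈
    with E≡
  ... | inj₁ E≡pq = pair-Adj E∈F E≡pq
  ... | inj₂ E≡qp with qp , q∈ , p∈ ← pair-Adj E∈F E≡qp = Adj-sym qp , p∈ , q∈

  pairs-orderly : Orderly (pairs F)
  pairs-orderly E∈ E′∈ E≡ab E′≡cd
    with E∈F , _ ← ∈-filter⁻ isPair? {xs = F} E∈ | E′∈F , _ ← ∈-filter⁻ isPair? {xs = F} E′∈ =
    φ-reflects-< (∈-vertexList E∈F (∈-cast E≡ab (here refl)))
      (∈-vertexList E′∈F (∈-cast E′≡cd (there (here refl))))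
      (<-≤-trans (proj₁ (image-crosses E∈F E≡ab)) (proj₂ (image-crosses E′∈F E′≡cd)))
    where
    image-crosses : ∀ {E x y} (E∈F : E ∈ F) → elems E ≡ x ∷ y ∷ [] → φ x < m × m ≤ φ y
    image-crosses E∈F E≡xy =
      crossing-ends (∈-lookup (f (index E∈F))) (image-pair _ (at-index E∈F E≡xy))

  nonPairs-singletons : Singletons (nonPairs F)
  nonPairs-singletons = All.tabulate λ E∈ → singleton (∈-filter⁻ (∁? isPair?) {xs = F} E∈)
    where
    singleton : ∀ {E} → E ∈ F × ¬ IsPair E → ∃[ a ] (elems E ≡ a ∷ [])
    singleton {E} (E∈F , ¬pair) with elems E in eq
    ... | [] = ⊥-elim (nonempty E eq)
    ... | a ∷ [] = a , refl
    ... | a ∷ b ∷ [] = ⊥-elim (¬pair (a , b , refl))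
    ... | a ∷ b ∷ c ∷ rest = ⊥-elim (edge-size≤2 (index E∈F) (at-index E∈F eq))

  pairs-simple : Injective _≡_ _≡_ f → Simple H → Simple (pairs F)
  pairs-simple f-injective H-simple = AllPairsₚ.map⁺ (AllPairs-restrict (all-filter isPair? F)
    (AllPairsₚ.filter⁺ isPair? (subst (AllPairs _) (tabulate-lookup F)
      (AllPairsₚ.tabulate⁺ distinct))))
    where
    distinct : ∀ {i j} → i ≢ j → IsPair (lookup F i) → IsPair (lookup F j) →
      elems (lookup F i) ≢ elems (lookup F j)
    distinct i≢j (a , b , Fi≡ab) _ Fi≡Fj = i≢j (f-injective (lookup-injective H H-simple
      (trans (image-pair _ Fi≡ab) (sym (image-pair _ (trans (sym Fi≡Fj) Fi≡ab))))))

  Linked-⊆vertexList : ∀ {a ℓ} → a ∈ vertexList F → Linked (Adj (pairs F)) (a ∷ ℓ) →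
    All (_∈ vertexList F) (a ∷ ℓ)
  Linked-⊆vertexList {ℓ = []} a∈ _ = a∈ ∷ []
  Linked-⊆vertexList {ℓ = b ∷ ℓ} a∈ (e ∷ linked) =
    a∈ ∷ Linked-⊆vertexList (proj₂ (proj₂ (pairs-Adj e))) linked

  -- φ maps a cycle of pairs F to a cycle of H on equally many vertices, and by the pigeonhole
  -- principle these are at most length (vertexList F) ≤ r.
  pairs-acyclic : ∀ {r} → ShortCycleFree r H → length (vertexList F) ≤ r → ¬ HasCycle (pairs F)
  pairs-acyclic {r} H-free F≤r (u , mid , w , unique , 1≤mid , linked , wu) =
    H-free mid<r
      (unique′ , subst (1 ≤_) (sym (length-map φ mid)) 1≤mid , linked′ , proj₁ (pairs-Adj wu))
    where
    C⊆V : All (_∈ vertexList F) (u ∷ mid ++ w ∷ [])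
    C⊆V = Linked-⊆vertexList (proj₂ (proj₂ (pairs-Adj wu))) linked
    map-C : map φ (u ∷ mid ++ w ∷ []) ≡ φ u ∷ map φ mid ++ φ w ∷ []
    map-C = cong (φ u ∷_) (map-++ φ mid (w ∷ []))
    unique′ : Unique (φ u ∷ map φ mid ++ φ w ∷ [])
    unique′ = subst Unique map-C (AllPairsₚ.map⁺ (AllPairs-restrict C⊆V
      (AllPairs.map (λ x≢y x∈ y∈ → x≢y ∘ φ-injective x∈ y∈) unique)))
    linked′ : Linked (Adj H) (φ u ∷ map φ mid ++ φ w ∷ [])
    linked′ =
      subst (Linked (Adj H)) map-C (Linkedₚ.map⁺ (Linked.map (proj₁ ∘ pairs-Adj) linked))
    mid<r : length (map φ mid) < r
    mid<r = subst (_< r) (sym (length-map φ mid))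
      (≤-trans (s≤s (length-++-≤ˡ mid)) (≤-trans (pigeonhole unique C⊆V) F≤r))

≻⇒OrderlyBipartiteForestWithSingletons : ∀ {F H m r} → All (Crosses m) H → Simple H →
  ShortCycleFree r H → length (vertexList F) ≤ r → H ≻ F → OrderlyBipartiteForestWithSingletons F
≻⇒OrderlyBipartiteForestWithSingletons {F} crossing simple free F≤r
  (φ , φ-mono , f , f-injective , f-edge) =
  pairs F , nonPairs F , ↭-pairs++nonPairs F ,
  (all-filter isPair? F , pairs-simple f-injective simple , pairs-acyclic free F≤r , pairs-orderly) ,
  nonPairs-singletons
  where open Embedding {F} crossing φ φ-mono f f-edge

^-distribʳ-* : ∀ a b n → (a * b) ^ n ≡ a ^ n * b ^ n
^-distribʳ-* a b zero = refl
^-distribʳ-* a b (suc n) rewrite ^-distribʳ-* a b n = interchange a b (a ^ n) (b ^ n)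
  where
  interchange : ∀ a b x y → a * b * (x * y) ≡ a * x * (b * y)
  interchange = solve-∀

root : ℕ → ℕ → ℕ
root r zero = 0
root r (suc K) with suc (root r K) ^ r ≤? suc K
... | yes _ = suc (root r K)
... | no _ = root r K

root-spec : ∀ r .{{_ : NonZero r}} K → root r K ^ r ≤ K × K < suc (root r K) ^ r
root-spec r@(suc _) zero = z≤n , m^n>0 1 r
root-spec r (suc K) with suc (root r K) ^ r ≤? suc K | root-spec r K
... | yes [1+t]ʳ≤1+K | _ , K<[1+t]ʳ = [1+t]ʳ≤1+K , ≤-<-trans K<[1+t]ʳ (^-monoˡ-< r (n<1+n _))
... | no [1+t]ʳ≰1+K | tʳ≤K , _ = m≤n⇒m≤1+n tʳ≤K , ≰⇒> [1+t]ʳ≰1+K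

root-bracket : ∀ r .{{_ : NonZero r}} {K} → 2 ^ r ≤ K →
  ∃[ d ] (1 ≤ d × suc d ^ r ≤ K × K < suc (suc d) ^ r)
root-bracket r {K} 2ʳ≤K with root r K | root-spec r K
... | zero | _ , K<1ʳ = ⊥-elim (<⇒≱ K<1ʳ (≤-trans (^-monoˡ-≤ r (s≤s z≤n)) 2ʳ≤K))
... | suc zero | _ , K<2ʳ = ⊥-elim (<⇒≱ K<2ʳ 2ʳ≤K)
... | suc (suc d) | [2+d]ʳ≤K , K<[3+d]ʳ = suc d , s≤s z≤n , [2+d]ʳ≤K , K<[3+d]ʳ

m*4≤n⇒m≤n/4 : ∀ {m n} → m * 4 ≤ n → m ≤ n / 4
m*4≤n⇒m≤n/4 {m} {n} m*4≤n = subst (_≤ n / 4) (m*n/n≡m m 4) (/-monoˡ-≤ 4 m*4≤n)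

n≤7*[n/4] : ∀ n → 1 ≤ n / 4 → n ≤ 7 * (n / 4)
n≤7*[n/4] n 1≤n/4 = begin
  n                        ≡⟨ m≡m%n+[m/n]*n n 4 ⟩
  n % 4 + n / 4 * 4        ≤⟨ +-monoˡ-≤ _ (≤-trans (≤-pred (m%n<n n 4)) (*-monoʳ-≤ 3 1≤n/4)) ⟩
  3 * (n / 4) + n / 4 * 4  ≡⟨ 3K+4K≡7K (n / 4) ⟩
  7 * (n / 4)              ∎
  where
  open ≤-Reasoning
  3K+4K≡7K : ∀ K → 3 * K + K * 4 ≡ 7 * K
  3K+4K≡7K = solve-∀

-- e ≥ dK/2 and K < (d+2)^r make e^r of order K^(r+1); the constant 294 = 7²·6 absorbs
-- n ≤ 7K, 7^(r+1) ≤ 49^r and (d+2)K ≤ 6e.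
n^[1+r]<[294*e]^r : ∀ r .{{_ : NonZero r}} {n K d e} → 1 ≤ K → 1 ≤ d → n ≤ 7 * K →
  K < suc (suc d) ^ r → d * K ≤ 2 * e → n ^ suc r < (294 * e) ^ r
n^[1+r]<[294*e]^r r {n} {K} {d} {e} 1≤K 1≤d n≤7K K<[2+d]ʳ dK≤2e = begin-strict
  n ^ suc r                          ≤⟨ ^-monoˡ-≤ (suc r) n≤7K ⟩
  (7 * K) ^ suc r                    ≡⟨ ^-distribʳ-* 7 K (suc r) ⟩
  7 ^ suc r * (K * K ^ r)            <⟨ *-monoʳ-< (7 ^ suc r) {{m^n≢0 7 (suc r)}}
                                          (*-monoˡ-< (K ^ r) {{m^n≢0 K r {{>-nonZero 1≤K}}}} K<[2+d]ʳ) ⟩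
  7 ^ suc r * ((2 + d) ^ r * K ^ r)  ≡⟨ cong (7 ^ suc r *_) (^-distribʳ-* (2 + d) K r) ⟨
  7 ^ suc r * ((2 + d) * K) ^ r      ≤⟨ *-mono-≤ 7^[1+r]≤49^r (^-monoˡ-≤ r [2+d]K≤6e) ⟩
  49 ^ r * (6 * e) ^ r               ≡⟨ ^-distribʳ-* 49 (6 * e) r ⟨
  (49 * (6 * e)) ^ r                 ≡⟨ cong (_^ r) (*-assoc 49 6 e) ⟨
  (294 * e) ^ r                      ∎
  where
  open ≤-Reasoning
  7^[1+r]≤49^r : 7 ^ suc r ≤ 49 ^ r
  7^[1+r]≤49^r = begin
    7 * 7 ^ r      ≤⟨ *-monoˡ-≤ (7 ^ r) (^-monoʳ-≤ 7 (>-nonZero⁻¹ r)) ⟩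
    7 ^ r * 7 ^ r  ≡⟨ ^-distribʳ-* 7 7 r ⟨
    49 ^ r         ∎
  2d+d≡3d : ∀ d → 2 * d + d ≡ 3 * d
  2d+d≡3d = solve-∀
  2+d≤3d : 2 + d ≤ 3 * d
  2+d≤3d = ≤-trans (+-monoˡ-≤ d (*-monoʳ-≤ 2 1≤d)) (≤-reflexive (2d+d≡3d d))
  [2+d]K≤6e : (2 + d) * K ≤ 6 * e
  [2+d]K≤6e = begin
    (2 + d) * K   ≤⟨ *-monoˡ-≤ K 2+d≤3d ⟩
    3 * d * K     ≡⟨ *-assoc 3 d K ⟩
    3 * (d * K)   ≤⟨ *-monoʳ-≤ 3 dK≤2e ⟩
    3 * (2 * e)   ≡⟨ *-assoc 3 2 e ⟨
    6 * e         ∎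

lemma3 : (F : Hypergraph) → ¬ OrderlyBipartiteForestWithSingletons F →
    ∃[ p ] ∃[ q ] ∃[ c ] ∃[ N ] (1 ≤ q × q < p ×
      ((n : ℕ) → N ≤ n →
        ∃[ H ] (Simple H × v H ≤ n × ¬ (H ≻ F) × n ^ p < (c * e H) ^ q)))
lemma3 F F-not = suc r , r , 294 , 2 ^ r * 4 , s≤s z≤n , n<1+n r , extremal
  where
  r : ℕ
  r = suc (length (vertexList F))
  extremal : (n : ℕ) → 2 ^ r * 4 ≤ n →
    ∃[ H ] (Simple H × v H ≤ n × ¬ (H ≻ F) × n ^ suc r < (294 * e H) ^ r)
  extremal n N≤n
    with d , 1≤d , [1+d]ʳ≤K , K<[2+d]ʳ ← root-bracket r (m*4≤n⇒m≤n/4 N≤n)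
    with H , simple , v≤4K , dK≤2e , crossing , free ← high-girth-graph r (n / 4) d [1+d]ʳ≤K =
    H , simple , ≤-trans v≤4K (m/n*n≤m n 4) ,
    F-not ∘ ≻⇒OrderlyBipartiteForestWithSingletons crossing simple free (n≤1+n _) ,
    n^[1+r]<[294*e]^r r {e = e H} 1≤K 1≤d (n≤7*[n/4] n 1≤K) K<[2+d]ʳ dK≤2e
    where
    1≤K : 1 ≤ n / 4
    1≤K = ≤-trans (m^n>0 2 r) (m*4≤n⇒m≤n/4 N≤n)
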